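{- Let $G$ be a loopless multigraph of maximum degree $\Delta\ge2$, let $\phi$ be a proper partial $\lfloor 3\Delta/2\rfloor$-edge-coloring, and let $C_1=F_1+P_1$ and $C_2=F_2+P_2$ be disjoint $\phi$-happy Shannon chains, each being the output of the Shannon Chain procedure applied to $\phi$ and some uncolored edge and pivot vertex. Then $C_1$ is $\mathsf{Aug}(\phi,C_2)$-happy and $C_2$ is $\mathsf{Aug}(\phi,C_1)$-happy.
   Context: Colors are $[r]$, $r=\lfloor 3\Delta/2\rfloor$, ordered as integers. A partial coloring is $\phi:E(G)\to[r]\cup\{\mathsf{blank}\}$; proper means distinct colored edges sharing an endpoint get distinct colors; $M(\phi,v)$ is the set of colors missing at $v$. A chain is a sequence of distinct edges $(e_0,\dots,e_{k-1})$ with $|V(e_i)\cap V(e_{i+1})|=1$; $E(C)$, $V(C)$ are its edges and their endpoints; $\mathsf{End}(C)=e_{k-1}$. $\mathsf{Shift}(\phi,C)$ gives $e_i$ the color $\phi(e_{i+1})$ ($i<k-1$), uncolors $e_{k-1}$, keeps other edges; $C$ is $\phi$-shiftable if $\phi(e_0)=\mathsf{blank}$ and $\mathsf{Shift}(\phi,C)$ is proper; an uncolored edge $uv$ is $\phi$-happy if $M(\phi,u)\cap M(\phi,v)\ne\varnothing$; $C$ is $\phi$-happy if shiftable and $\mathsf{End}(C)$ is $\mathsf{Shift}(\phi,C)$-happy. For chains $C=(e_0,\dots,e_{k-1})$, $C'=(f_0,\dots,f_{j-1})$ with $e_{k-1}=f_0$, $C+C'=(e_0,\dots,e_{k-1},f_1,\dots,f_{j-1})$.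 A fan is a chain whose edges share a vertex $x$ (pivot); $V(F)$ its vertex set. $G(\phi,\alpha\beta)$ is the spanning subgraph of edges colored $\alpha$ or $\beta$. For an uncolored edge $h$ with endpoints $u,v$ where $\alpha\in M(\phi,u)$, $P(h;\phi,\alpha\beta)$ is the chain $(h,h_1,\dots,h_s)$ where $(h_1,\dots,h_s)$ is the maximal path in $G(\phi,\alpha\beta)$ starting at $v$ with first edge colored $\alpha$ ($s=0$ if none); $\mathsf{vEnd}$ of it is the last vertex of this path ($v$ if $s=0$). First Shannon Fan procedure on $(\phi,e,x)$ (with $y$ the other endpoint of $e$): if $M(\phi,x)\cap M(\phi,y)\ne\varnothing$ return $((e),\beta,\beta)$ with $\beta$ its minimum; else set $\eta=\min M(\phi,y)$, $f$ the edge at $x$ colored $\eta$, $z$ its other endpoint; if $M(\phi,x)\cap M(\phi,z)\ne\varnothing$ return $((e,f),\beta,\beta)$ with $\beta$ its minimum; else return $((e,f),\alpha,\beta)$ with $\beta=\min M(\phi,y)\cap M(\phi,z)$, $\alpha=\min M(\phi,x)$. Shannon Chain procedure on $(\phi,e,x)$: let $(F,\alpha,\beta)$ be the output of First Shannon Fan. If $\beta\in M(\phi,x)$ output $F$ and $P=(\mathsf{End}(F))$. Otherwise let $P=P(\mathsf{End}(F);\mathsf{Shift}(\phi,F),\alpha\beta)$ and $P'=P(e;\phi,\alpha\beta)$; if $\mathsf{vEnd}(P)\ne x$ output $F,P$, else output $(e),P'$. The output chain is $F+P$, and $\alpha,\beta$ are called its colors. For such a $\phi$-happy chain $C$ with colors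 $\alpha,\beta$, $\mathsf{Aug}(\phi,C)$ is obtained from $\mathsf{Shift}(\phi,C)$ by giving $\mathsf{End}(C)$ whichever of $\alpha,\beta$ is missing at both its endpoints. Two such chains $C_1=F_1+P_1$, $C_2=F_2+P_2$ are disjoint if $E(C_1)\cap E(C_2)=\varnothing$ and $(V(F_1)\cup\{\mathsf{vEnd}(P_1)\})\cap(V(F_2)\cup\{\mathsf{vEnd}(P_2)\})=\varnothing$. -}

module Defs where

open import Data.Nat using (ℕ; _≤_)
open import Data.Fin using (Fin)
import Data.Fin as F
open import Data.Fin.Properties using (_≟_)
open import Data.Product using (Σ; ∃; _×_; _,_; proj₁; proj₂)
open import Data.Sum using (_⊎_)
open import Data.Maybe using (Maybe; just; nothing)
open import Data.Bool using (if_then_else_)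
open import Data.Unit using (⊤)
open import Data.List using (List; []; _∷_; length; filter)
open import Data.List.NonEmpty using (List⁺; _∷_; toList; head; tail; last; _⁺++_; [_])
open import Data.List.Membership.Propositional using (_∈_; _∉_)
open import Data.List.Relation.Unary.Any using (Any)
open import Data.List.Relation.Unary.Linked using (Linked)
open import Data.List.Relation.Unary.Unique.Propositional using (Unique)
open import Data.List.Base using (allFin)
open import Relation.Binary.PropositionalEquality using (_≡_; _≢_)
open import Relation.Nullary using (¬_; Dec)
open import Relation.Nullary.Decidable using (⌊_⌋; _⊎-dec_)

-- Loopless multigraphs: vertices Fin n, edges Fin m, each edge has an
-- (ordered, for bookkeeping only) pair of distinct endpoints.

record Multigraph : Set where
  field
    nV : ℕ
    nE : ℕ
    ends : Fin nE → Fin nV × Fin nV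
    loopless : ∀ e → proj₁ (ends e) ≢ proj₂ (ends e)

module _ (G : Multigraph) where
  open Multigraph G

  Vertex : Set
  Vertex = Fin nV

  Edge : Set
  Edge = Fin nE

  Incident : Edge → Vertex → Set
  Incident g v = proj₁ (ends g) ≡ v ⊎ proj₂ (ends g) ≡ v

  incident? : ∀ g v → Dec (Incident g v)
  incident? g v = (proj₁ (ends g) ≟ v) ⊎-dec (proj₂ (ends g) ≟ v)

  Ends : Edge → Vertex → Vertex → Set
  Ends g u w = ends g ≡ (u , w) ⊎ ends g ≡ (w , u)

  degree : Vertex → ℕ
  degree v = length (filter (λ g → incident? g v) (allFin nE))

  MaxDegree : ℕ → Set
  MaxDegree Δ = (∀ v → degree v ≤ Δ) × (∃ λ v → degree v ≡ Δ)

  ShareOne : Edge → Edge → Set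
  ShareOne g h = Σ Vertex λ v → Incident g v × Incident h v ×
                   (∀ w → Incident g w → Incident h w → w ≡ v)

  IsChain : List⁺ Edge → Set
  IsChain C = Unique (toList C) × Linked ShareOne (toList C)

  InV : List⁺ Edge → Vertex → Set
  InV C v = Any (λ g → Incident g v) (toList C)

  -- chain concatenation C + C' (assumes head C' = last C)
  _+C_ : List⁺ Edge → List⁺ Edge → List⁺ Edge
  C +C C' = C ⁺++ tail C'

  module _ (r : ℕ) where

    Color : Set
    Color = Fin r

    -- partial coloring; nothing = blank
    Coloring : Set
    Coloring = Edge → Maybe Color

    Proper : Coloring → Set
    Proper φ = ∀ g h → g ≢ h → ∀ v → Incident g v → Incident h v →
                 ∀ c d → φ g ≡ just c → φ h ≡ just d → c ≢ d

    Missing : Coloring → Vertex → Color → Set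
    Missing φ v c = ∀ g → Incident g v → φ g ≢ just c

    CommonMissing : Coloring → Vertex → Vertex → Color → Set
    CommonMissing φ u w c = Missing φ u c × Missing φ w c

    IsMin : (Color → Set) → Color → Set
    IsMin S c = S c × (∀ d → S d → c F.≤ d)

    shift : Coloring → List⁺ Edge → Coloring
    shift φ C = go (head C) (tail C)
      where
      go : Edge → List Edge → Coloring
      go e [] g = if ⌊ g ≟ e ⌋ then nothing else φ g
      go e (e' ∷ es) g = if ⌊ g ≟ e ⌋ then φ e' else go e' es g

    HappyEdge : Coloring → Edge → Set
    HappyEdge φ h = φ h ≡ nothing ×
      Σ Color λ c → CommonMissing φ (proj₁ (ends h)) (proj₂ (ends h)) c

    Shiftable : Coloring → List⁺ Edge → Set
    Shiftable φ C = φ (head C) ≡ nothing × Proper (shift φ C)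

    HappyChain : Coloring → List⁺ Edge → Set
    HappyChain φ C = Shiftable φ C × HappyEdge (shift φ C) (last C)

    aug : Coloring → List⁺ Edge → Color → Coloring
    aug φ C γ g = if ⌊ g ≟ last C ⌋ then just γ else shift φ C g

    AugColor : Coloring → List⁺ Edge → Color → Color → Color → Set
    AugColor φ C α β γ = (γ ≡ α ⊎ γ ≡ β) ×
      CommonMissing (shift φ C) (proj₁ (ends (last C))) (proj₂ (ends (last C))) γ

    -- First Shannon Fan procedure on (φ, e, x), y the other endpoint of e;
    -- relation between input and output (F, α, β)
    data FirstShannonFan (φ : Coloring) (e : Edge) (x y : Vertex)
         : List⁺ Edge → Color → Color → Set where
      fan1 : ∀ {β} → IsMin (CommonMissing φ x y) β →
             FirstShannonFan φ e x y [ e ] β β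
      fan2 : ∀ {η f z β} → (∀ c → ¬ CommonMissing φ x y c) →
             IsMin (Missing φ y) η → Ends f x z → φ f ≡ just η →
             IsMin (CommonMissing φ x z) β →
             FirstShannonFan φ e x y (e ∷ f ∷ []) β β
      fan3 : ∀ {η f z α β} → (∀ c → ¬ CommonMissing φ x y c) →
             IsMin (Missing φ y) η → Ends f x z → φ f ≡ just η →
             (∀ c → ¬ CommonMissing φ x z c) →
             IsMin (CommonMissing φ y z) β → IsMin (Missing φ x) α →
             FirstShannonFan φ e x y (e ∷ f ∷ []) α β

    -- a path in G(φ, αβ) starting at a vertex, with its edge list and the
    -- list of vertices visited after the start vertex
    data ABPath (φ : Coloring) (α β : Color) : Vertex → List Edge → List Vertex → Set where
      nil  : ∀ {v} → ABPath φ α β v [] []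
      step : ∀ {v w h hs ws} → Ends h v w → (φ h ≡ just α ⊎ φ h ≡ just β) →
             ABPath φ α β w hs ws → ABPath φ α β v (h ∷ hs) (w ∷ ws)

    lastV : Vertex → List Vertex → Vertex
    lastV v [] = v
    lastV v (w ∷ ws) = lastV w ws

    FirstIsα : Coloring → Color → List Edge → Set
    FirstIsα φ α [] = ⊤
    FirstIsα φ α (h ∷ _) = φ h ≡ just α

    -- P(h; φ, αβ) = P with vEnd(P) = t, where h has endpoints u, v
    -- (α ∈ M(φ,u)) and the path starts at v
    record KempeChain (φ : Coloring) (α β : Color) (h : Edge) (u v : Vertex)
                      (P : List⁺ Edge) (t : Vertex) : Set where
      field
        hs : List Edge
        ws : List Vertex
        shape   : P ≡ h ∷ hs
        ends-h  : Ends h u v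
        path    : ABPath φ α β v hs ws
        distinct : Unique (v ∷ ws)
        firstα  : FirstIsα φ α hs
        vEnd    : t ≡ lastV v ws
        maxNil  : hs ≡ [] → ∀ g w → Ends g v w → φ g ≢ just α
        maxCons : hs ≢ [] → ∀ g w → Ends g t w →
                  (φ g ≡ just α ⊎ φ g ≡ just β) → w ∈ (v ∷ ws)

    -- Shannon Chain procedure applied to (φ, e, x): output (F, P) with
    -- colors α, β and vEnd(P) = t
    data ShannonChain (φ : Coloring) (e : Edge) (x : Vertex)
         : List⁺ Edge → List⁺ Edge → Color → Color → Vertex → Set where
      caseA : ∀ {y F α β t} → φ e ≡ nothing → Ends e x y →
              FirstShannonFan φ e x y F α β → Missing φ x β →
              Ends (last F) x t →
              ShannonChain φ e x F [ last F ] α β t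
      caseB : ∀ {y F α β w P t} → φ e ≡ nothing → Ends e x y →
              FirstShannonFan φ e x y F α β → ¬ Missing φ x β →
              Ends (last F) x w →
              KempeChain (shift φ F) α β (last F) x w P t → t ≢ x →
              ShannonChain φ e x F P α β t
      caseC : ∀ {y F α β w P t P' t'} → φ e ≡ nothing → Ends e x y →
              FirstShannonFan φ e x y F α β → ¬ Missing φ x β →
              Ends (last F) x w →
              KempeChain (shift φ F) α β (last F) x w P t → t ≡ x →
              KempeChain φ α β e x y P' t' →
              ShannonChain φ e x [ e ] P' α β t'

    Disjoint : List⁺ Edge → List⁺ Edge → Vertex → List⁺ Edge → List⁺ Edge → Vertex → Set
    Disjoint F₁ P₁ t₁ F₂ P₂ t₂ =
      (∀ g → g ∈ toList (F₁ +C P₁) → g ∉ toList (F₂ +C P₂)) ×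
      (∀ v → (InV F₁ v ⊎ v ≡ t₁) → ¬ (InV F₂ v ⊎ v ≡ t₂))

module Submission where

open import Defs
open import Data.Nat using (ℕ; zero; suc; pred; _≤_; _<_; _+_; _*_; z≤n; s≤s; _≤?_; _<?_)
open import Data.Nat.DivMod using (_/_)
open import Data.Nat.Properties
  using (≤-refl; ≤-reflexive; n≤1+n; ≤-trans; ≤-antisym; ≤-total; <⇒≤; <-irrefl; n<1+n; 1+n≰n;
         m≤n⇒m≤1+n; m≤n⇒m<n∨m≡n; ≤-pred; ≰⇒>; ≮⇒≥; m≤n⇒∃[o]m+o≡n;
         +-monoˡ-<; +-identityʳ; +-suc; m<m+n; m≤n+m)
open import Data.Fin.Properties using (_≟_)
open import Data.Product using (∃; _×_; _,_; proj₁; proj₂)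
open import Data.Sum using (_⊎_; inj₁; inj₂; swap)
import Data.Sum as Sum
open import Data.Maybe using (Maybe; just; nothing)
open import Data.Maybe.Properties using (just-injective)
open import Data.Bool using (if_then_else_)
open import Data.Empty using (⊥; ⊥-elim)
open import Data.List using (List; []; _∷_; length; initLast; _∷ʳ′_; _∷ʳ_)
open import Data.List.NonEmpty using (List⁺; _∷_; toList; head; tail; last; [_])
open import Data.List.Membership.Propositional using (_∈_; _∉_)
open import Data.List.Membership.Propositional.Properties using (∈-++⁺ˡ)
open import Data.List.Relation.Unary.Any using (here; there; any?)
import Data.List.Relation.Unary.All as All
open import Data.List.Relation.Unary.AllPairs using ([]; _∷_)
open import Data.List.Relation.Unary.Unique.Propositional using (Unique)
open import Relation.Binary.PropositionalEquality using (_≡_; _≢_; refl; sym; trans; cong; subst)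
open import Relation.Nullary using (¬_; Dec; yes; no)
open import Relation.Nullary.Decidable using (⌊_⌋; _⊎-dec_)

-- Write A(C) = V(F) ∪ {vEnd(P)} for a Shannon chain C = F + P. Away from A(C), shifting or
-- augmenting C only trades the colours α, β along the αβ-path, so every colour that Shift or Aug
-- puts at such a vertex on an edge of C was already there on an edge of C. Moreover End(C) has a
-- happy colour already present on C at each endpoint outside A(C): the colour of the penultimate
-- edge when the path leaves V(F), and any happy colour otherwise. Since A(C₁) and A(C₂) are
-- disjoint, every potential conflict between Shift(Aug(φ, C₂), C₁) and its happy colour sits
-- outside A(C₁) or outside A(C₂), where it is already a conflict of Shift(φ, C₁) or Aug(φ, C₂).
-- The delicate point is case C of the Shannon Chain procedure: there vEnd(P') ≠ x because two
-- αβ-walks from distinct β-free vertices cannot end at the same α-free vertex.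
-- Neither Δ nor the number of colours plays any role.

module _ {A : Set} where

  -- nth d xs i is the junk value d once i ≥ length xs.
  nth : A → List A → ℕ → A
  nth d []       _       = d
  nth d (x ∷ xs) zero    = x
  nth d (x ∷ xs) (suc i) = nth d xs i

  nth-∈ : (d : A) (xs : List A) {i : ℕ} → i < length xs → nth d xs i ∈ xs
  nth-∈ d (x ∷ xs) {zero}  _         = here refl
  nth-∈ d (x ∷ xs) {suc i} (s≤s i<n) = there (nth-∈ d xs i<n)

  ∈⇒nth : (d : A) {x : A} (xs : List A) → x ∈ xs → ∃ λ i → i < length xs × nth d xs i ≡ x
  ∈⇒nth d (y ∷ xs) (here refl)  = zero , s≤s z≤n , refl
  ∈⇒nth d (y ∷ xs) (there x∈xs) with ∈⇒nth d xs x∈xs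
  ... | i , i<n , eq = suc i , s≤s i<n , eq

  nth-injective : (d : A) (xs : List A) → Unique xs → ∀ {i j} → i < length xs → j < length xs →
                  nth d xs i ≡ nth d xs j → i ≡ j
  nth-injective d (x ∷ xs) _         {zero}  {zero}  _          _          _  = refl
  nth-injective d (x ∷ xs) (x∉ ∷ _)  {zero}  {suc j} _          (s≤s j<n)  eq = ⊥-elim (All.lookup x∉ (nth-∈ d xs j<n) eq)
  nth-injective d (x ∷ xs) (x∉ ∷ _)  {suc i} {zero}  (s≤s i<n)  _          eq = ⊥-elim (All.lookup x∉ (nth-∈ d xs i<n) (sym eq))
  nth-injective d (x ∷ xs) (_ ∷ xs-unique) {suc i} {suc j} (s≤s i<n)  (s≤s j<n)  eq = cong suc (nth-injective d xs xs-unique i<n j<n eq)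

  last≡nth : (x : A) (xs : List A) → last (x ∷ xs) ≡ nth x (x ∷ xs) (length xs)
  last≡nth x xs with initLast xs
  ... | []       = refl
  ... | ys ∷ʳ′ y = nth-snoc x ys
    where
    nth-snoc : ∀ z zs → y ≡ nth x (z ∷ (zs ∷ʳ y)) (length (zs ∷ʳ y))
    nth-snoc z []        = refl
    nth-snoc z (z' ∷ zs) = nth-snoc z' zs

length>0⇒≢[] : ∀ {A : Set} {xs : List A} → 0 < length xs → xs ≢ []
length>0⇒≢[] {xs = []}    ()
length>0⇒≢[] {xs = _ ∷ _} _  ()

<⇒≡suc : ∀ {m n} → m < n → ∃ λ j → n ≡ suc j × m ≤ j
<⇒≡suc (s≤s m≤j) = _ , refl , m≤j

module _ (G : Multigraph) where
  open Multigraph G using (ends; loopless)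

  private
    Vtx = Vertex G
    Edg = Edge G
    Inc = Incident G
    Joins = Ends G

  open import Data.List.Membership.DecPropositional {A = Edge G} _≟_ using (_∈?_)

  Joins⇒Incˡ : ∀ {g u w} → Joins g u w → Inc g u
  Joins⇒Incˡ (inj₁ eq) = inj₁ (cong proj₁ eq)
  Joins⇒Incˡ (inj₂ eq) = inj₂ (cong proj₂ eq)

  Joins⇒Incʳ : ∀ {g u w} → Joins g u w → Inc g w
  Joins⇒Incʳ (inj₁ eq) = inj₂ (cong proj₂ eq)
  Joins⇒Incʳ (inj₂ eq) = inj₁ (cong proj₁ eq)

  Joins-sym : ∀ {g u w} → Joins g u w → Joins g w u
  Joins-sym = swap

  Inc⇒endpoint : ∀ {g u w v} → Joins g u w → Inc g v → v ≡ u ⊎ v ≡ w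
  Inc⇒endpoint (inj₁ eq) (inj₁ p) = inj₁ (trans (sym p) (cong proj₁ eq))
  Inc⇒endpoint (inj₁ eq) (inj₂ p) = inj₂ (trans (sym p) (cong proj₂ eq))
  Inc⇒endpoint (inj₂ eq) (inj₁ p) = inj₂ (trans (sym p) (cong proj₁ eq))
  Inc⇒endpoint (inj₂ eq) (inj₂ p) = inj₁ (trans (sym p) (cong proj₂ eq))

  Inc⇒Joins : ∀ {g v} → Inc g v → ∃ λ w → Joins g v w
  Inc⇒Joins {g} (inj₁ refl) = proj₂ (ends g) , inj₁ refl
  Inc⇒Joins {g} (inj₂ refl) = proj₁ (ends g) , inj₂ refl

  Joins-irrefl : ∀ {g u} → ¬ Joins g u u
  Joins-irrefl {g} (inj₁ eq) = loopless g (trans (cong proj₁ eq) (sym (cong proj₂ eq)))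
  Joins-irrefl {g} (inj₂ eq) = loopless g (trans (cong proj₁ eq) (sym (cong proj₂ eq)))

  Joins⇒≢ : ∀ {g u w} → Joins g u w → u ≢ w
  Joins⇒≢ g-joins refl = Joins-irrefl g-joins

  Joins-functional : ∀ {g u w w'} → Joins g u w → Joins g u w' → w ≡ w'
  Joins-functional (inj₁ eq) (inj₁ eq') with trans (sym eq) eq'
  ... | refl = refl
  Joins-functional (inj₁ eq) (inj₂ eq') with trans (sym eq) eq'
  ... | refl = refl
  Joins-functional (inj₂ eq) (inj₁ eq') with trans (sym eq) eq'
  ... | refl = refl
  Joins-functional (inj₂ eq) (inj₂ eq') with trans (sym eq) eq'
  ... | refl = refl

  len : List⁺ Edg → ℕ
  len C = length (toList C)

  edgeAt : List⁺ Edg → ℕ → Edg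
  edgeAt C = nth (head C) (toList C)

  last-∈ : ∀ C → last C ∈ toList C
  last-∈ (e ∷ es) = subst (λ (g : Edg) → g ∈ e ∷ es) (sym (last≡nth e es)) (nth-∈ e (e ∷ es) ≤-refl)

  Anchor : List⁺ Edg → Vtx → Vtx → Set
  Anchor F t v = InV G F v ⊎ v ≡ t

  anchor? : ∀ F t v → Dec (Anchor F t v)
  anchor? F t v = any? (λ g → incident? G g v) (toList F) ⊎-dec (v ≟ t)

  if-≡ : ∀ {B : Set} {g h : Edg} (x y : B) → g ≡ h → (if ⌊ g ≟ h ⌋ then x else y) ≡ x
  if-≡ {g = g} {h} x y g≡h with g ≟ h
  ... | yes _   = refl
  ... | no g≢h = ⊥-elim (g≢h g≡h)

  if-≢ : ∀ {B : Set} {g h : Edg} (x y : B) → g ≢ h → (if ⌊ g ≟ h ⌋ then x else y) ≡ y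
  if-≢ {g = g} {h} x y g≢h with g ≟ h
  ... | yes g≡h = ⊥-elim (g≢h g≡h)
  ... | no _    = refl

  module _ (r : ℕ) where

    private
      Col = Color G r
      Colouring = Coloring G r
      Miss = Missing G r
      Shift = shift G r

    OneOf : Col → Col → Maybe Col → Set
    OneOf α β c = c ≡ just α ⊎ c ≡ just β

    oneOf-just : ∀ {α β c} → OneOf α β c → ∃ λ p → c ≡ just p
    oneOf-just (inj₁ c≡α) = _ , c≡α
    oneOf-just (inj₂ c≡β) = _ , c≡β

    oneOf-split : ∀ {α β p c c'} → OneOf α β p → OneOf α β c → OneOf α β c' → c ≢ c' → p ≡ c ⊎ p ≡ c'
    oneOf-split (inj₁ p≡α) (inj₁ c≡α) _           _    = inj₁ (trans p≡α (sym c≡α))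
    oneOf-split (inj₂ p≡β) (inj₂ c≡β) _           _    = inj₁ (trans p≡β (sym c≡β))
    oneOf-split (inj₁ p≡α) (inj₂ _)   (inj₁ c'≡α) _    = inj₂ (trans p≡α (sym c'≡α))
    oneOf-split (inj₂ p≡β) (inj₁ _)   (inj₂ c'≡β) _    = inj₂ (trans p≡β (sym c'≡β))
    oneOf-split (inj₁ _)   (inj₂ c≡β) (inj₂ c'≡β) c≢c' = ⊥-elim (c≢c' (trans c≡β (sym c'≡β)))
    oneOf-split (inj₂ _)   (inj₁ c≡α) (inj₁ c'≡α) c≢c' = ⊥-elim (c≢c' (trans c≡α (sym c'≡α)))

    oneOf-alternate : ∀ {α β c₁ c₂ c₃} → OneOf α β c₁ → OneOf α β c₂ → OneOf α β c₃ →
                      c₁ ≢ c₂ → c₂ ≢ c₃ → c₁ ≡ c₃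
    oneOf-alternate c₁-αβ c₂-αβ c₃-αβ c₁≢c₂ c₂≢c₃ with oneOf-split c₁-αβ c₂-αβ c₃-αβ c₂≢c₃
    ... | inj₁ c₁≡c₂ = ⊥-elim (c₁≢c₂ c₁≡c₂)
    ... | inj₂ c₁≡c₃ = c₁≡c₃

    α-free⇒β : ∀ {φ α β g x} → Miss φ x α → Inc g x → OneOf α β (φ g) → φ g ≡ just β
    α-free⇒β x-α-free g∋x (inj₁ φg≡α) = ⊥-elim (x-α-free _ g∋x φg≡α)
    α-free⇒β x-α-free g∋x (inj₂ φg≡β) = φg≡β

    missing-at-endpoint : ∀ {ψ h v c} → CommonMissing G r ψ (proj₁ (ends h)) (proj₂ (ends h)) c →
                          Inc h v → Miss ψ v c
    missing-at-endpoint (c-free₁ , _) (inj₁ refl) = c-free₁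
    missing-at-endpoint (_ , c-free₂) (inj₂ refl) = c-free₂

    proper-edge-unique : ∀ {φ g h v c} → Proper G r φ → Inc g v → Inc h v →
                         φ g ≡ just c → φ h ≡ just c → g ≡ h
    proper-edge-unique {g = g} {h} {v} {c} φ-proper g∋v h∋v φg φh with g ≟ h
    ... | yes g≡h = g≡h
    ... | no g≢h  = ⊥-elim (φ-proper g h g≢h v g∋v h∋v c c φg φh refl)

    proper-adjacent-differ : ∀ {φ g h v c} → Proper G r φ → g ≢ h → Inc g v → Inc h v →
                             φ g ≡ just c → φ g ≢ φ h
    proper-adjacent-differ {g = g} {h} {v} {c} φ-proper g≢h g∋v h∋v φg φg≡φh =
      φ-proper g h g≢h v g∋v h∋v c c φg (trans (sym φg≡φh) φg) refl

    Shift-next : ∀ φ (d : Edg) e es → Unique (e ∷ es) → ∀ {i} → suc i < length (e ∷ es) →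
                 Shift φ (e ∷ es) (nth d (e ∷ es) i) ≡ φ (nth d (e ∷ es) (suc i))
    Shift-next φ d e []         _          (s≤s ())
    Shift-next φ d e (e' ∷ es)  _          {zero}  _           = if-≡ {g = e} (φ e') _ refl
    Shift-next φ d e (e' ∷ es)  (e∉ ∷ es-unique) {suc i} (s≤s i+1<n) =
      trans (if-≢ (φ e') _ (λ eq → All.lookup e∉ (nth-∈ d (e' ∷ es) (<⇒≤ i+1<n)) (sym eq)))
            (Shift-next φ d e' es es-unique i+1<n)

    Shift-last : ∀ φ (d : Edg) e es → Unique (e ∷ es) → Shift φ (e ∷ es) (nth d (e ∷ es) (length es)) ≡ nothing
    Shift-last φ d e []        _          = if-≡ nothing (φ e) refl
    Shift-last φ d e (e' ∷ es) (e∉ ∷ es-unique) =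
      trans (if-≢ (φ e') _ (λ eq → All.lookup e∉ (nth-∈ d (e' ∷ es) ≤-refl) (sym eq)))
            (Shift-last φ d e' es es-unique)

    Shift-outside : ∀ φ {C} g → g ∉ toList C → Shift φ C g ≡ φ g
    Shift-outside φ {e ∷ es} = go e es
      where
      go : ∀ e es g → g ∉ e ∷ es → Shift φ (e ∷ es) g ≡ φ g
      go e []        g g∉ = if-≢ nothing (φ g) (λ eq → g∉ (here eq))
      go e (e' ∷ es) g g∉ = trans (if-≢ (φ e') _ (λ eq → g∉ (here eq))) (go e' es g (λ g∈ → g∉ (there g∈)))

    Shift-cong : ∀ φ φ' C g → (∀ h → h ∈ tail C → φ h ≡ φ' h) → φ g ≡ φ' g → Shift φ C g ≡ Shift φ' C g
    Shift-cong φ φ' (e ∷ es) g = go e es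
      where
      go : ∀ e es → (∀ h → h ∈ es → φ h ≡ φ' h) → φ g ≡ φ' g → Shift φ (e ∷ es) g ≡ Shift φ' (e ∷ es) g
      go e []        _     φg≡ with g ≟ e
      ... | yes _ = refl
      ... | no _  = φg≡
      go e (e' ∷ es) agree φg≡ with g ≟ e
      ... | yes _ = agree e' (here refl)
      ... | no _  = go e' es (λ h h∈ → agree h (there h∈)) φg≡

    aug-outside : ∀ {φ C γ g} → g ∉ toList C → aug G r φ C γ g ≡ φ g
    aug-outside {φ} {C} {γ} {g} g∉C =
      trans (if-≢ {g = g} {last C} (just γ) _ (λ g≡ → g∉C (subst (_∈ toList C) (sym g≡) (last-∈ C)))) (Shift-outside φ g g∉C)

    aug-proper : ∀ {φ C α β γ} → Proper G r (Shift φ C) → AugColor G r φ C α β γ → Proper G r (aug G r φ C γ)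
    aug-proper {C = C} sh-proper (_ , γ-free) g h g≢h v g∋v h∋v c d ψg ψh c≡d with g ≟ last C | h ≟ last C
    ... | yes refl | yes refl = g≢h refl
    ... | yes refl | no _     = missing-at-endpoint γ-free g∋v h h∋v (trans ψh (cong just (trans (sym c≡d) (sym (just-injective ψg)))))
    ... | no _     | yes refl = missing-at-endpoint γ-free h∋v g g∋v (trans ψg (cong just (trans c≡d (sym (just-injective ψh)))))
    ... | no _     | no _     = sh-proper g h g≢h v g∋v h∋v c d ψg ψh c≡d

    NoNewColour : Colouring → Colouring → List⁺ Edg → Vtx → Set
    NoNewColour φ ψ C v = ∀ g c → g ∈ toList C → Inc g v → ψ g ≡ just c →
                          ∃ λ g' → g' ∈ toList C × Inc g' v × φ g' ≡ just c

    HappyWitness : Colouring → List⁺ Edg → List⁺ Edg → Vtx → Col → Set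
    HappyWitness φ C F t c =
      CommonMissing G r (Shift φ C) (proj₁ (ends (last C))) (proj₂ (ends (last C))) c ×
      (∀ v → Inc (last C) v → Anchor F t v ⊎ ∃ λ g → g ∈ toList C × Inc g v × φ g ≡ just c)

    -- The only properties of a Shannon chain used when two disjoint chains interact.
    record Anchored (φ : Colouring) (C F : List⁺ Edg) (t : Vtx) (α β : Col) : Set where
      field
        shift-reuses : ∀ v → ¬ Anchor F t v → NoNewColour φ (Shift φ C) C v
        aug-reuses   : ∀ γ → γ ≡ α ⊎ γ ≡ β → ∀ v → ¬ Anchor F t v → NoNewColour φ (aug G r φ C γ) C v
        happy-colour : (∃ λ c → CommonMissing G r (Shift φ C) (proj₁ (ends (last C))) (proj₂ (ends (last C))) c) →
                       ∃ (HappyWitness φ C F t)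

    -- C = F + P read as a walk vertex 0, …, vertex (len C): the first fanSize edges are those of F,
    -- with their vertices in V(F), and the remaining ones are the αβ-coloured edges of P. The fields
    -- guarded by suc (suc fanSize) ≤ len C concern a path whose last edge leaves V(F).
    record Layout (φ : Colouring) (C F : List⁺ Edg) (t : Vtx) (α β : Col) : Set where
      field
        vertex     : ℕ → Vtx
        fanSize    : ℕ
        edge-joins : ∀ i → i < len C → Joins (edgeAt C i) (vertex i) (vertex (suc i))
        fan-vertex : ∀ j → j ≤ fanSize → InV G F (vertex j)
        vertex-end : vertex (len C) ≡ t
        path-colour : ∀ i → fanSize ≤ i → i < len C → OneOf α β (φ (edgeAt C i))
        path-vertex-injective : ∀ i j → fanSize ≤ i → i ≤ len C → fanSize ≤ j → j ≤ len C →
                                vertex i ≡ vertex j → i ≡ j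
        fan-misses-α⊎β : suc (suc fanSize) ≤ len C → ∀ j → j < fanSize →
                         Miss φ (vertex j) α ⊎ Miss φ (vertex j) β
        path-starts-α : suc (suc fanSize) ≤ len C → φ (edgeAt C fanSize) ≡ just α
        path-start-misses-β : suc (suc fanSize) ≤ len C → Miss φ (vertex fanSize) β
        fan-not-αβ : suc (suc fanSize) ≤ len C → ∀ i → suc i < fanSize → ¬ OneOf α β (φ (edgeAt C (suc i)))
        end≢pivot : suc (suc fanSize) ≤ len C → vertex (len C) ≢ vertex (pred fanSize)
        path-maximal : suc (suc fanSize) ≤ len C → ∀ g w → Joins g (vertex (len C)) w → OneOf α β (φ g) →
                       g ∉ toList C → ∃ λ j → fanSize ≤ j × j ≤ len C × vertex j ≡ w

    module LayoutProperties {φ : Colouring} (φ-proper : Proper G r φ)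
                            {e : Edg} {es : List Edg} (unique : Unique (e ∷ es))
                            {F : List⁺ Edg} {t : Vtx} {α β : Col} (L : Layout φ (e ∷ es) F t α β) where
      open Layout L

      private
        C : List⁺ Edg
        C = e ∷ es
        n k : ℕ
        n = length es
        k = suc n
        E : ℕ → Edg
        E = edgeAt C

      E-∈ : ∀ {i} → i < k → E i ∈ toList C
      E-∈ = nth-∈ e (e ∷ es)

      consecutive-colours-differ : ∀ {i} → fanSize ≤ i → suc i < k → φ (E i) ≢ φ (E (suc i))
      consecutive-colours-differ {i} m≤i i+1<k =
        proper-adjacent-differ φ-proper
          (λ eq → <-irrefl (nth-injective e (e ∷ es) unique (<⇒≤ i+1<k) i+1<k eq) (n<1+n i))
          (Joins⇒Incʳ (edge-joins i (<⇒≤ i+1<k))) (Joins⇒Incˡ (edge-joins (suc i) i+1<k))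
          (proj₂ (oneOf-just (path-colour i m≤i (<⇒≤ i+1<k))))

      interior-sees : ∀ {i γ} → fanSize < i → i < k → OneOf α β (just γ) →
                      ∃ λ g → g ∈ toList C × Inc g (vertex i) × φ g ≡ just γ
      interior-sees {suc i} (s≤s m≤i) i+1<k γ-αβ
        with oneOf-split γ-αβ (path-colour i m≤i (<⇒≤ i+1<k)) (path-colour (suc i) (m≤n⇒m≤1+n m≤i) i+1<k)
                         (consecutive-colours-differ m≤i i+1<k)
      ... | inj₁ γ≡ = E i , E-∈ (<⇒≤ i+1<k) , Joins⇒Incʳ (edge-joins i (<⇒≤ i+1<k)) , sym γ≡
      ... | inj₂ γ≡ = E (suc i) , E-∈ i+1<k , Joins⇒Incˡ (edge-joins (suc i) i+1<k) , sym γ≡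

      interior-reserved : ∀ {g i γ} → g ∉ toList C → fanSize < i → i < k → Inc g (vertex i) →
                          OneOf α β (just γ) → φ g ≢ just γ
      interior-reserved g∉C m<i i<k g∋ γ-αβ φg with interior-sees m<i i<k γ-αβ
      ... | g' , g'∈C , g'∋ , φg' = g∉C (subst (_∈ toList C) (proper-edge-unique φ-proper g'∋ g∋ φg' φg) g'∈C)

      unanchored⇒interior : ∀ {i} → ¬ Anchor F t (vertex i) → fanSize < i
      unanchored⇒interior {i} ¬A with i ≤? fanSize
      ... | yes i≤m = ⊥-elim (¬A (inj₁ (fan-vertex i i≤m)))
      ... | no i≰m  = ≰⇒> i≰m

      interior-not-missing : ∀ {i γ} → fanSize < i → i < k → OneOf α β (just γ) → ¬ Miss φ (vertex i) γ
      interior-not-missing m<i i<k γ-αβ γ-free with interior-sees m<i i<k γ-αβ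
      ... | g , _ , g∋ , φg = γ-free g g∋ φg

      interior-vertex-injective : ∀ {i j} → fanSize < i → i < k → j ≤ k → vertex i ≡ vertex j → i ≡ j
      interior-vertex-injective {i} {j} m<i i<k j≤k vi≡vj with fanSize ≤? j
      ... | yes m≤j = path-vertex-injective i j (<⇒≤ m<i) (<⇒≤ i<k) m≤j j≤k vi≡vj
      ... | no m≰j with fan-misses-α⊎β (≤-trans (s≤s m<i) i<k) j (≰⇒> m≰j)
      ...   | inj₁ α-free = ⊥-elim (interior-not-missing m<i i<k (inj₁ refl) (subst (λ v → Miss φ v α) (sym vi≡vj) α-free))
      ...   | inj₂ β-free = ⊥-elim (interior-not-missing m<i i<k (inj₂ refl) (subst (λ v → Miss φ v β) (sym vi≡vj) β-free))

      end-fresh : ∀ {j} → fanSize ≤ j → j < k → vertex k ≢ vertex j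
      end-fresh m≤j j<k vk≡vj =
        <-irrefl (sym (path-vertex-injective k _ (≤-trans m≤j (<⇒≤ j<k)) ≤-refl m≤j (<⇒≤ j<k) vk≡vj)) j<k

      last-endpoint : ∀ {v} → Inc (last C) v → v ≡ vertex n ⊎ v ≡ vertex k
      last-endpoint v∋ = Inc⇒endpoint (edge-joins n ≤-refl) (subst (λ g → Inc g _) (last≡nth e es) v∋)

      shifted-colour : ∀ {i c} → i < k → Shift φ C (E i) ≡ just c → i < n × φ (E (suc i)) ≡ just c
      shifted-colour {i} i<k shifted with m≤n⇒m<n∨m≡n (≤-pred i<k)
      ... | inj₂ refl = ⊥-elim (nothing≢just (trans (sym (Shift-last φ e e es unique)) shifted))
        where
        nothing≢just : ∀ {c : Col} → nothing ≢ just c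
        nothing≢just ()
      ... | inj₁ i<n  = i<n , trans (sym (Shift-next φ e e es unique (s≤s i<n))) shifted

      shift-reuses : ∀ v → ¬ Anchor F t v → NoNewColour φ (Shift φ C) C v
      shift-reuses v ¬A g c g∈C g∋ shifted with ∈⇒nth e (e ∷ es) g∈C
      ... | i , i<k , refl with shifted-colour i<k shifted | Inc⇒endpoint (edge-joins i i<k) g∋
      ...   | i<n , φE | inj₂ refl = E (suc i) , E-∈ (s≤s i<n) , Joins⇒Incˡ (edge-joins (suc i) (s≤s i<n)) , φE
      ...   | i<n , φE | inj₁ refl = interior-sees m<i i<k (subst (OneOf α β) φE (path-colour (suc i) m≤i+1 (s≤s i<n)))
        where
        m<i = unanchored⇒interior ¬A
        m≤i+1 = m≤n⇒m≤1+n (<⇒≤ m<i)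

      aug-reuses : ∀ γ → γ ≡ α ⊎ γ ≡ β → ∀ v → ¬ Anchor F t v → NoNewColour φ (aug G r φ C γ) C v
      aug-reuses γ γ-αβ v ¬A g c g∈C g∋ augmented with g ≟ last C
      ... | no _     = shift-reuses v ¬A g c g∈C g∋ augmented
      ... | yes refl with last-endpoint g∋ | just-injective augmented
      ...   | inj₂ refl | _    = ⊥-elim (¬A (inj₂ vertex-end))
      ...   | inj₁ refl | refl = interior-sees (unanchored⇒interior ¬A) ≤-refl (Sum.map (cong just) (cong just) γ-αβ)

      path-start-reserved : suc (suc fanSize) ≤ k → ∀ {g} → g ∉ toList C → Inc g (vertex fanSize) → ¬ OneOf α β (φ g)
      path-start-reserved long g∉C g∋ (inj₁ φg≡α) =
        g∉C (subst (_∈ toList C) (proper-edge-unique φ-proper (Joins⇒Incˡ (edge-joins fanSize (<⇒≤ long))) g∋ (path-starts-α long) φg≡α)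
                   (E-∈ (<⇒≤ long)))
      path-start-reserved long g∉C g∋ (inj₂ φg≡β) = path-start-misses-β long _ g∋ φg≡β

      module _ {j : ℕ} (n≡1+j : n ≡ suc j) (m≤j : fanSize ≤ j) where
        private
          j+1<k : suc j < k
          j+1<k = ≤-reflexive (cong suc (sym n≡1+j))
          j<k : j < k
          j<k = <⇒≤ j+1<k
          long : suc (suc fanSize) ≤ k
          long = ≤-trans (s≤s (s≤s m≤j)) j+1<k
          p : Col
          p = proj₁ (oneOf-just (path-colour j m≤j j<k))
          φE≡p : φ (E j) ≡ just p
          φE≡p = proj₂ (oneOf-just (path-colour j m≤j j<k))
          p-αβ : OneOf α β (just p)
          p-αβ = subst (OneOf α β) φE≡p (path-colour j m≤j j<k)

        penultimate-colour-free-at-start : Miss (Shift φ C) (vertex (suc j)) p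
        penultimate-colour-free-at-start g g∋ shifted with g ∈? toList C
        ... | no g∉C = interior-reserved g∉C (s≤s m≤j) j+1<k g∋ p-αβ (trans (sym (Shift-outside φ g g∉C)) shifted)
        ... | yes g∈C with ∈⇒nth e (e ∷ es) g∈C
        ...   | i , i<k , refl with shifted-colour i<k shifted | Inc⇒endpoint (edge-joins i i<k) g∋
        ...     | i<n , _  | inj₁ vj+1≡vi =
          <-irrefl (sym (interior-vertex-injective (s≤s m≤j) j+1<k (<⇒≤ i<k) vj+1≡vi)) (subst (i <_) n≡1+j i<n)
        ...     | _   , φE | inj₂ vj+1≡vi+1 with interior-vertex-injective (s≤s m≤j) j+1<k i<k vj+1≡vi+1
        ...       | refl = consecutive-colours-differ m≤j j+1<k (trans φE≡p (sym φE))

        p-absent-outside-at-end : ∀ {g} → g ∉ toList C → Inc g (vertex k) → φ g ≢ just p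
        p-absent-outside-at-end {g} g∉C g∋ φg with Inc⇒Joins g∋
        ... | w , g-joins with path-maximal long g w g-joins (subst (OneOf α β) (sym φg) p-αβ) g∉C
        ...   | i , m≤i , i≤k , refl with m≤n⇒m<n∨m≡n m≤i | m≤n⇒m<n∨m≡n i≤k
        ...     | inj₂ refl | _         = path-start-reserved long g∉C (Joins⇒Incʳ g-joins) (subst (OneOf α β) (sym φg) p-αβ)
        ...     | inj₁ _    | inj₂ refl = Joins-irrefl g-joins
        ...     | inj₁ m<i  | inj₁ i<k  = interior-reserved g∉C m<i i<k (Joins⇒Incʳ g-joins) p-αβ φg

        p-absent-on-chain-at-end : ∀ {i} → i < k → Inc (E i) (vertex k) → Shift φ C (E i) ≢ just p
        p-absent-on-chain-at-end {i} i<k g∋ shifted with shifted-colour i<k shifted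
        ... | i<n , φE with fanSize ≤? suc i
        ...   | no m≰i+1 = fan-not-αβ long i (≰⇒> m≰i+1) (subst (OneOf α β) (sym φE) p-αβ)
        ...   | yes m≤i+1 with Inc⇒endpoint (edge-joins i i<k) g∋
        ...     | inj₂ vk≡vi+1 = end-fresh m≤i+1 (s≤s i<n) vk≡vi+1
        ...     | inj₁ vk≡vi with fanSize ≤? i
        ...       | yes m≤i = end-fresh m≤i i<k vk≡vi
        ...       | no m≰i  = end≢pivot long (subst (λ q → vertex k ≡ vertex q) i≡pred vk≡vi)
          where
          i≡pred : i ≡ pred fanSize
          i≡pred = cong pred (sym (≤-antisym m≤i+1 (≰⇒> m≰i)))

        penultimate-colour-free-at-end : Miss (Shift φ C) (vertex k) p
        penultimate-colour-free-at-end g g∋ shifted with g ∈? toList C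
        ... | no g∉C = p-absent-outside-at-end g∉C g∋ (trans (sym (Shift-outside φ g g∉C)) shifted)
        ... | yes g∈C with ∈⇒nth e (e ∷ es) g∈C
        ...   | i , i<k , refl = p-absent-on-chain-at-end i<k g∋ shifted

        long-path-witness : ∃ (HappyWitness φ C F t)
        long-path-witness = p , (p-free (inj₁ refl) , p-free (inj₂ refl)) , p-present
          where
          p-free : ∀ {v} → Inc (last C) v → Miss (Shift φ C) v p
          p-free v∋ with last-endpoint v∋
          ... | inj₁ refl = subst (λ q → Miss (Shift φ C) (vertex q) p) (sym n≡1+j) penultimate-colour-free-at-start
          ... | inj₂ refl = penultimate-colour-free-at-end
          p-present : ∀ v → Inc (last C) v → Anchor F t v ⊎ ∃ λ g → g ∈ toList C × Inc g v × φ g ≡ just p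
          p-present v v∋ with last-endpoint v∋
          ... | inj₁ refl = inj₂ (E j , E-∈ j<k , subst (λ q → Inc (E j) (vertex q)) (sym n≡1+j) (Joins⇒Incʳ (edge-joins j j<k)) , φE≡p)
          ... | inj₂ refl = inj₁ (inj₂ vertex-end)

      short-path-anchored : n ≤ fanSize → ∀ {v} → Inc (last C) v → Anchor F t v
      short-path-anchored n≤m v∋ with last-endpoint v∋
      ... | inj₁ refl = inj₁ (fan-vertex n n≤m)
      ... | inj₂ refl = inj₂ vertex-end

      happy-colour : (∃ λ c → CommonMissing G r (Shift φ C) (proj₁ (ends (last C))) (proj₂ (ends (last C))) c) →
                     ∃ (HappyWitness φ C F t)
      happy-colour (c , c-free) with fanSize <? n
      ... | yes m<n = let (_ , n≡1+j , m≤j) = <⇒≡suc m<n in long-path-witness n≡1+j m≤j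
      ... | no m≮n  = c , c-free , λ v v∋ → inj₁ (short-path-anchored (≮⇒≥ m≮n) v∋)

      anchored : Anchored φ C F t α β
      anchored = record { shift-reuses = shift-reuses ; aug-reuses = aug-reuses ; happy-colour = happy-colour }

    module Interaction {φ : Colouring} (φ-proper : Proper G r φ)
      {C₁ C₂ F₁ F₂ : List⁺ Edg} {t₁ t₂ : Vtx} {α₁ β₁ α₂ β₂ : Col}
      (anchored₁ : Anchored φ C₁ F₁ t₁ α₁ β₁) (anchored₂ : Anchored φ C₂ F₂ t₂ α₂ β₂)
      (happy₁ : HappyChain G r φ C₁) (happy₂ : HappyChain G r φ C₂)
      (edges-disjoint : ∀ g → g ∈ toList C₁ → g ∉ toList C₂)
      (anchors-disjoint : ∀ v → Anchor F₁ t₁ v → ¬ Anchor F₂ t₂ v)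
      {γ : Col} (γ-aug : AugColor G r φ C₂ α₂ β₂ γ) where

      open Anchored

      private
        φ₂ ψ : Colouring
        φ₂ = aug G r φ C₂ γ
        ψ = Shift φ₂ C₁

      C₁-shift-proper : Proper G r (Shift φ C₁)
      C₁-shift-proper = proj₂ (proj₁ happy₁)

      φ₂-proper : Proper G r φ₂
      φ₂-proper = aug-proper {φ} {C₂} (proj₂ (proj₁ happy₂)) γ-aug

      φ₂-on-C₁ : ∀ {g} → g ∈ toList C₁ → φ₂ g ≡ φ g
      φ₂-on-C₁ g∈ = aug-outside {φ} {C₂} (edges-disjoint _ g∈)

      ψ-on-C₁ : ∀ {g} → g ∈ toList C₁ → ψ g ≡ Shift φ C₁ g
      ψ-on-C₁ g∈ = Shift-cong φ₂ φ C₁ _ (λ h h∈ → φ₂-on-C₁ (there h∈)) (φ₂-on-C₁ g∈)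

      ψ-off-C₁ : ∀ {g} → g ∉ toList C₁ → ψ g ≡ φ₂ g
      ψ-off-C₁ = Shift-outside φ₂ _

      C₂-edge-off-C₁ : ∀ {g} → g ∈ toList C₂ → Shift φ C₁ g ≡ φ g
      C₂-edge-off-C₁ g∈₂ = Shift-outside φ _ (λ g∈₁ → edges-disjoint _ g∈₁ g∈₂)

      -- At an anchor of C₁ the colours of C₂ are old ones since anchors are disjoint; elsewhere
      -- the colours of C₁ are old ones.
      no-clash-across : ∀ {g h v c} → g ∈ toList C₁ → h ∉ toList C₁ → Inc g v → Inc h v →
                        Shift φ C₁ g ≡ just c → φ₂ h ≡ just c → ⊥
      no-clash-across {g} {h} {v} {c} g∈₁ h∉₁ g∋ h∋ sg φ₂h with h ∈? toList C₂
      ... | no h∉₂ = h∉₁ (subst (_∈ toList C₁) (proper-edge-unique C₁-shift-proper g∋ h∋ sg sh) g∈₁)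
        where
        sh = trans (Shift-outside φ h h∉₁) (trans (sym (aug-outside {φ} {C₂} h∉₂)) φ₂h)
      ... | yes h∈₂ with anchor? F₁ t₁ v
      ...   | yes A₁ with aug-reuses anchored₂ γ (proj₁ γ-aug) v (anchors-disjoint v A₁) h c h∈₂ h∋ φ₂h
      ...     | g' , g'∈₂ , g'∋ , φg' =
        edges-disjoint g g∈₁ (subst (_∈ toList C₂) (sym (proper-edge-unique C₁-shift-proper g∋ g'∋ sg (trans (C₂-edge-off-C₁ g'∈₂) φg'))) g'∈₂)
      no-clash-across {g} {h} {v} {c} g∈₁ h∉₁ g∋ h∋ sg φ₂h | yes _ | no ¬A₁ with shift-reuses anchored₁ v ¬A₁ g c g∈₁ g∋ sg
      ...     | g' , g'∈₁ , g'∋ , φg' =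
        h∉₁ (subst (_∈ toList C₁) (proper-edge-unique φ₂-proper g'∋ h∋ (trans (φ₂-on-C₁ g'∈₁) φg') φ₂h) g'∈₁)

      ψ-proper : Proper G r ψ
      ψ-proper g h g≢h v g∋ h∋ c d ψg ψh c≡d with g ∈? toList C₁ | h ∈? toList C₁
      ... | yes g∈ | yes h∈ = C₁-shift-proper g h g≢h v g∋ h∋ c d (trans (sym (ψ-on-C₁ g∈)) ψg) (trans (sym (ψ-on-C₁ h∈)) ψh) c≡d
      ... | no g∉  | no h∉  = φ₂-proper g h g≢h v g∋ h∋ c d (trans (sym (ψ-off-C₁ g∉)) ψg) (trans (sym (ψ-off-C₁ h∉)) ψh) c≡d
      ... | yes g∈ | no h∉  = no-clash-across g∈ h∉ g∋ h∋ (trans (sym (ψ-on-C₁ g∈)) ψg)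
                                (trans (sym (ψ-off-C₁ h∉)) (trans ψh (cong just (sym c≡d))))
      ... | no g∉  | yes h∈ = no-clash-across h∈ g∉ h∋ g∋ (trans (sym (ψ-on-C₁ h∈)) ψh)
                                (trans (sym (ψ-off-C₁ g∉)) (trans ψg (cong just c≡d)))

      private
        witness = happy-colour anchored₁ (proj₂ (proj₂ happy₁))
        c = proj₁ witness
        c-free = proj₁ (proj₂ witness)
        c-present = proj₂ (proj₂ witness)

      c-still-free : ∀ {v} → Inc (last C₁) v → Miss ψ v c
      c-still-free v∋ g g∋ ψg with g ∈? toList C₁
      ... | yes g∈₁ = missing-at-endpoint c-free v∋ g g∋ (trans (sym (ψ-on-C₁ g∈₁)) ψg)
      ... | no g∉₁ with g ∈? toList C₂
      ...   | no g∉₂ = missing-at-endpoint c-free v∋ g g∋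
                         (trans (Shift-outside φ g g∉₁) (trans (sym (aug-outside {φ} {C₂} g∉₂)) (trans (sym (ψ-off-C₁ g∉₁)) ψg)))
      ...   | yes g∈₂ with anchor? F₂ t₂ _
      ...     | no ¬A₂ with aug-reuses anchored₂ γ (proj₁ γ-aug) _ ¬A₂ g c g∈₂ g∋ (trans (sym (ψ-off-C₁ g∉₁)) ψg)
      ...       | g' , g'∈₂ , g'∋ , φg' = missing-at-endpoint c-free v∋ g' g'∋ (trans (C₂-edge-off-C₁ g'∈₂) φg')
      c-still-free v∋ g g∋ ψg | no g∉₁ | yes _ | yes A₂ with c-present _ v∋
      ...       | inj₁ A₁ = anchors-disjoint _ A₁ A₂
      ...       | inj₂ (g₁ , g₁∈ , g₁∋ , φg₁) =
        g∉₁ (subst (_∈ toList C₁) (proper-edge-unique φ₂-proper g₁∋ g∋ (trans (φ₂-on-C₁ g₁∈) φg₁) (trans (sym (ψ-off-C₁ g∉₁)) ψg)) g₁∈)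

      stays-happy : HappyChain G r φ₂ C₁
      stays-happy =
        (trans (φ₂-on-C₁ (here refl)) (proj₁ (proj₁ happy₁)) , ψ-proper) ,
        trans (ψ-on-C₁ (last-∈ C₁)) (proj₁ (proj₂ happy₁)) ,
        c , c-still-free (inj₁ refl) , c-still-free (inj₂ refl)

    lastV≡nth : ∀ (dv v : Vtx) ws → lastV G r v ws ≡ nth dv (v ∷ ws) (length ws)
    lastV≡nth dv v []       = refl
    lastV≡nth dv v (w ∷ ws) = lastV≡nth dv w ws

    module _ {ψ : Colouring} {α β : Col} where

      ABPath-length : ∀ {v hs ws} → ABPath G r ψ α β v hs ws → length ws ≡ length hs
      ABPath-length nil          = refl
      ABPath-length (step _ _ p) = cong suc (ABPath-length p)

      ABPath-joins : ∀ {v hs ws} (d : Edg) (dv : Vtx) → ABPath G r ψ α β v hs ws → ∀ {j} → j < length hs →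
                     Joins (nth d hs j) (nth dv (v ∷ ws) j) (nth dv (v ∷ ws) (suc j))
      ABPath-joins d dv (step h-joins _ _) {zero}  _         = h-joins
      ABPath-joins d dv (step _ _ p)       {suc j} (s≤s j<n) = ABPath-joins d dv p j<n

      ABPath-colour : ∀ {v hs ws} (d : Edg) → ABPath G r ψ α β v hs ws → ∀ {j} → j < length hs → OneOf α β (ψ (nth d hs j))
      ABPath-colour d (step _ h-αβ _) {zero}  _         = h-αβ
      ABPath-colour d (step _ _ p)    {suc j} (s≤s j<n) = ABPath-colour d p j<n

      ABPath-end : ∀ {v hs ws} (dv : Vtx) → ABPath G r ψ α β v hs ws → lastV G r v ws ≡ nth dv (v ∷ ws) (length hs)
      ABPath-end {v} {ws = ws} dv p = trans (lastV≡nth dv v ws) (cong (nth dv (v ∷ ws)) (ABPath-length p))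

      ABPath-vertex-injective : ∀ {v hs ws} (dv : Vtx) → ABPath G r ψ α β v hs ws → Unique (v ∷ ws) →
                                ∀ {a b} → a ≤ length hs → b ≤ length hs → nth dv (v ∷ ws) a ≡ nth dv (v ∷ ws) b → a ≡ b
      ABPath-vertex-injective {v} {ws = ws} dv p distinct a≤n b≤n =
        nth-injective dv (v ∷ ws) distinct (s≤s (≤-trans a≤n (≤-reflexive (sym (ABPath-length p)))))
                                           (s≤s (≤-trans b≤n (≤-reflexive (sym (ABPath-length p)))))

      ABPath-vertex-index : ∀ {v hs ws w} (dv : Vtx) → ABPath G r ψ α β v hs ws → w ∈ v ∷ ws →
                            ∃ λ a → a ≤ length hs × nth dv (v ∷ ws) a ≡ w
      ABPath-vertex-index {v} {ws = ws} dv p w∈ with ∈⇒nth dv (v ∷ ws) w∈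
      ... | a , s≤s a≤m , eq = a , ≤-trans a≤m (≤-reflexive (ABPath-length p)) , eq

    FirstIsα-head : ∀ {ψ α} (d : Edg) hs → 0 < length hs → FirstIsα G r ψ α hs → ψ (nth d hs 0) ≡ just α
    FirstIsα-head d (_ ∷ _) _ first = first

    module ShannonLayouts {φ : Colouring} (φ-proper : Proper G r φ) where

      fan-layout : ∀ {C t α β} (vertex : ℕ → Vtx) →
                   (∀ i → i < len C → Joins (edgeAt C i) (vertex i) (vertex (suc i))) →
                   (∀ j → j ≤ len C → InV G C (vertex j)) → vertex (len C) ≡ t → Layout φ C C t α β
      fan-layout {C} vertex joins in-fan end = record
        { vertex = vertex ; fanSize = len C ; edge-joins = joins ; fan-vertex = in-fan ; vertex-end = end
        ; path-colour = λ _ k≤i i<k → ⊥-elim (1+n≰n (≤-trans i<k k≤i))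
        ; path-vertex-injective = λ _ _ k≤i i≤k k≤j j≤k _ → trans (≤-antisym i≤k k≤i) (≤-antisym k≤j j≤k)
        ; fan-misses-α⊎β = λ long → ⊥-elim (no-long long)
        ; path-starts-α = λ long → ⊥-elim (no-long long)
        ; path-start-misses-β = λ long → ⊥-elim (no-long long)
        ; fan-not-αβ = λ long → ⊥-elim (no-long long)
        ; end≢pivot = λ long → ⊥-elim (no-long long)
        ; path-maximal = λ long → ⊥-elim (no-long long)
        }
        where
        no-long : ¬ suc (suc (len C)) ≤ len C
        no-long long = 1+n≰n (<⇒≤ long)

      caseA₁-layout : ∀ {e x y t α β} → Joins e x y → Joins e x t → Layout φ [ e ] [ e ] t α β
      caseA₁-layout {e} {x} {y} e-xy e-xt = fan-layout (nth x (x ∷ y ∷ [])) joins in-fan (Joins-functional e-xy e-xt)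
        where
        joins : ∀ i → i < 1 → Joins (edgeAt [ e ] i) (nth x (x ∷ y ∷ []) i) (nth x (x ∷ y ∷ []) (suc i))
        joins zero    _        = e-xy
        joins (suc _) (s≤s ())
        in-fan : ∀ j → j ≤ 1 → InV G [ e ] (nth x (x ∷ y ∷ []) j)
        in-fan zero          _         = here (Joins⇒Incˡ e-xy)
        in-fan (suc zero)    _         = here (Joins⇒Incʳ e-xy)
        in-fan (suc (suc _)) (s≤s ())

      caseA₂-layout : ∀ {e f x y z t α β} → Joins e x y → Joins f x z → Joins f x t →
                      Layout φ (e ∷ f ∷ []) (e ∷ f ∷ []) t α β
      caseA₂-layout {e} {f} {x} {y} {z} e-xy f-xz f-xt = fan-layout vertex joins in-fan (Joins-functional f-xz f-xt)
        where
        vertex = nth y (y ∷ x ∷ z ∷ [])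
        joins : ∀ i → i < 2 → Joins (edgeAt (e ∷ f ∷ []) i) (vertex i) (vertex (suc i))
        joins zero          _              = Joins-sym e-xy
        joins (suc zero)    _              = f-xz
        joins (suc (suc _)) (s≤s (s≤s ()))
        in-fan : ∀ j → j ≤ 2 → InV G (e ∷ f ∷ []) (vertex j)
        in-fan zero                _              = here (Joins⇒Incʳ e-xy)
        in-fan (suc zero)          _              = here (Joins⇒Incˡ e-xy)
        in-fan (suc (suc zero))    _              = there (here (Joins⇒Incʳ f-xz))
        in-fan (suc (suc (suc _))) (s≤s (s≤s ()))

      fan-edge-not-αβ : ∀ {f x w α β} → Joins f x w → Miss φ x α → Miss φ w β → ¬ OneOf α β (φ f)
      fan-edge-not-αβ f-xw x-α _   (inj₁ φf≡α) = x-α _ (Joins⇒Incˡ f-xw) φf≡α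
      fan-edge-not-αβ f-xw _   w-β (inj₂ φf≡β) = w-β _ (Joins⇒Incʳ f-xw) φf≡β

      fan-shift-keeps-αβ : ∀ {e f x w α β} g → Joins f x w → Miss φ x α → Miss φ w β →
                           OneOf α β (Shift φ (e ∷ f ∷ []) g) → Shift φ (e ∷ f ∷ []) g ≡ φ g
      fan-shift-keeps-αβ {e} {f} g f-xw x-α w-β αβ with g ≟ e
      ... | yes _ = ⊥-elim (fan-edge-not-αβ f-xw x-α w-β αβ)
      ... | no _ with g ≟ f
      ...   | yes _ = ⊥-elim (Sum.[ (λ ()) , (λ ()) ] αβ)
      ...   | no _  = refl

      caseB-layout : ∀ {e f x y w α β P t} → Joins e x y → Miss φ x α → Miss φ y β → Miss φ w β →
                     KempeChain G r (Shift φ (e ∷ f ∷ [])) α β f x w P t → t ≢ x →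
                     Layout φ (_+C_ G (e ∷ f ∷ []) P) (e ∷ f ∷ []) t α β
      caseB-layout {e} {f} {x} {y} {w} {α} {β} {t = t} e-xy x-α y-β w-β
        record { hs = hs ; ws = ws ; shape = refl ; ends-h = f-xw ; path = path ; distinct = distinct
               ; firstα = firstα ; vEnd = vEnd ; maxCons = maximal } t≢x = record
        { vertex = vertex ; fanSize = 2 ; edge-joins = joins ; fan-vertex = in-fan ; vertex-end = end
        ; path-colour = colour ; path-vertex-injective = injective ; fan-misses-α⊎β = λ _ → fan-misses
        ; path-starts-α = λ long → trans (sym (to-φ _ (inj₁ (first long)))) (first long)
        ; path-start-misses-β = λ _ → w-β ; fan-not-αβ = λ _ → f-not-αβ
        ; end≢pivot = λ _ vk≡x → t≢x (trans (sym end) vk≡x) ; path-maximal = maximal-at-end }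
        where
        C = e ∷ f ∷ hs
        vertex = nth y (y ∷ x ∷ w ∷ ws)

        to-φ : ∀ g → OneOf α β (Shift φ (e ∷ f ∷ []) g) → Shift φ (e ∷ f ∷ []) g ≡ φ g
        to-φ g = fan-shift-keeps-αβ g f-xw x-α w-β

        joins : ∀ i → i < len C → Joins (edgeAt C i) (vertex i) (vertex (suc i))
        joins zero          _                = Joins-sym e-xy
        joins (suc zero)    _                = f-xw
        joins (suc (suc i)) (s≤s (s≤s i<n)) = ABPath-joins e y path i<n

        in-fan : ∀ j → j ≤ 2 → InV G (e ∷ f ∷ []) (vertex j)
        in-fan zero                _              = here (Joins⇒Incʳ e-xy)
        in-fan (suc zero)          _              = here (Joins⇒Incˡ e-xy)
        in-fan (suc (suc zero))    _              = there (here (Joins⇒Incʳ f-xw))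
        in-fan (suc (suc (suc _))) (s≤s (s≤s ()))

        end : vertex (len C) ≡ t
        end = sym (trans vEnd (ABPath-end y path))

        colour : ∀ i → 2 ≤ i → i < len C → OneOf α β (φ (edgeAt C i))
        colour _ (s≤s (s≤s _)) (s≤s (s≤s i<n)) = subst (OneOf α β) (to-φ _ αβ) αβ
          where
          αβ = ABPath-colour e path i<n

        injective : ∀ i j → 2 ≤ i → i ≤ len C → 2 ≤ j → j ≤ len C → vertex i ≡ vertex j → i ≡ j
        injective _ _ (s≤s (s≤s _)) (s≤s (s≤s i≤n)) (s≤s (s≤s _)) (s≤s (s≤s j≤n)) eq =
          cong (λ q → suc (suc q)) (ABPath-vertex-injective y path distinct i≤n j≤n eq)

        fan-misses : ∀ j → j < 2 → Miss φ (vertex j) α ⊎ Miss φ (vertex j) β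
        fan-misses zero          _              = inj₂ y-β
        fan-misses (suc zero)    _              = inj₁ x-α
        fan-misses (suc (suc _)) (s≤s (s≤s ()))

        nonempty : suc (suc 2) ≤ len C → 0 < length hs
        nonempty long = ≤-trans (s≤s z≤n) (≤-pred (≤-pred long))

        first : suc (suc 2) ≤ len C → Shift φ (e ∷ f ∷ []) (nth e hs 0) ≡ just α
        first long = FirstIsα-head e hs (nonempty long) firstα

        f-not-αβ : ∀ i → suc i < 2 → ¬ OneOf α β (φ (edgeAt C (suc i)))
        f-not-αβ zero    _              = fan-edge-not-αβ f-xw x-α w-β
        f-not-αβ (suc _) (s≤s (s≤s ()))

        maximal-at-end : suc (suc 2) ≤ len C → ∀ g w' → Joins g (vertex (len C)) w' → OneOf α β (φ g) →
                         g ∉ toList C → ∃ λ j → 2 ≤ j × j ≤ len C × vertex j ≡ w'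
        maximal-at-end long g w' g-joins αβ g∉C
          with ABPath-vertex-index y path
                 (maximal (length>0⇒≢[] (nonempty long)) g w' (subst (λ v → Joins g v w') end g-joins)
                          (subst (OneOf α β) (sym (Shift-outside φ {e ∷ f ∷ []} g (λ g∈ → g∉C (∈-++⁺ˡ g∈)))) αβ))
        ... | a , a≤n , eq = suc (suc a) , s≤s (s≤s z≤n) , s≤s (s≤s a≤n) , eq

      caseC-layout : ∀ {e x y α β P t} → Miss φ x α → Miss φ y β → KempeChain G r φ α β e x y P t → t ≢ x →
                     Layout φ (_+C_ G [ e ] P) [ e ] t α β
      caseC-layout {e} {x} {y} {α} {β} {t = t} x-α y-β
        record { hs = hs ; ws = ws ; shape = refl ; ends-h = e-xy ; path = path ; distinct = distinct
               ; firstα = firstα ; vEnd = vEnd ; maxCons = maximal } t≢x = record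
        { vertex = vertex ; fanSize = 1 ; edge-joins = joins ; fan-vertex = in-fan ; vertex-end = end
        ; path-colour = colour ; path-vertex-injective = injective ; fan-misses-α⊎β = λ _ → fan-misses
        ; path-starts-α = λ long → FirstIsα-head e hs (nonempty long) firstα
        ; path-start-misses-β = λ _ → y-β ; fan-not-αβ = λ _ → no-fan-edge
        ; end≢pivot = λ _ vk≡x → t≢x (trans (sym end) vk≡x) ; path-maximal = maximal-at-end }
        where
        C = e ∷ hs
        vertex = nth x (x ∷ y ∷ ws)

        joins : ∀ i → i < len C → Joins (edgeAt C i) (vertex i) (vertex (suc i))
        joins zero    _         = e-xy
        joins (suc i) (s≤s i<n) = ABPath-joins e x path i<n

        in-fan : ∀ j → j ≤ 1 → InV G [ e ] (vertex j)
        in-fan zero          _        = here (Joins⇒Incˡ e-xy)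
        in-fan (suc zero)    _        = here (Joins⇒Incʳ e-xy)
        in-fan (suc (suc _)) (s≤s ())

        end : vertex (len C) ≡ t
        end = sym (trans vEnd (ABPath-end x path))

        colour : ∀ i → 1 ≤ i → i < len C → OneOf α β (φ (edgeAt C i))
        colour _ (s≤s _) (s≤s i<n) = ABPath-colour e path i<n

        injective : ∀ i j → 1 ≤ i → i ≤ len C → 1 ≤ j → j ≤ len C → vertex i ≡ vertex j → i ≡ j
        injective _ _ (s≤s _) (s≤s i≤n) (s≤s _) (s≤s j≤n) eq =
          cong suc (ABPath-vertex-injective x path distinct i≤n j≤n eq)

        fan-misses : ∀ j → j < 1 → Miss φ (vertex j) α ⊎ Miss φ (vertex j) β
        fan-misses zero    _        = inj₁ x-α
        fan-misses (suc _) (s≤s ())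

        nonempty : suc (suc 1) ≤ len C → 0 < length hs
        nonempty long = ≤-trans (s≤s z≤n) (≤-pred long)

        no-fan-edge : ∀ i → suc i < 1 → ¬ OneOf α β (φ (edgeAt C (suc i)))
        no-fan-edge _ (s≤s ())

        maximal-at-end : suc (suc 1) ≤ len C → ∀ g w' → Joins g (vertex (len C)) w' → OneOf α β (φ g) →
                         g ∉ toList C → ∃ λ j → 1 ≤ j × j ≤ len C × vertex j ≡ w'
        maximal-at-end long g w' g-joins αβ _
          with ABPath-vertex-index x path (maximal (length>0⇒≢[] (nonempty long)) g w' (subst (λ v → Joins g v w') end g-joins) αβ)
        ... | a , a≤n , eq = suc a , s≤s z≤n , s≤s a≤n , eq

      record AlternatingWalk (α β : Col) (a : ℕ → Vtx) (A : ℕ → Edg) (n : ℕ) : Set where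
        field
          walk-joins  : ∀ {i} → i < n → Joins (A i) (a i) (a (suc i))
          walk-colour : ∀ {i} → i < n → OneOf α β (φ (A i))
          walk-turns  : ∀ {i} → suc i < n → A i ≢ A (suc i)

      open AlternatingWalk

      walk-colours-differ : ∀ {α β a A n} → AlternatingWalk α β a A n → ∀ {i} → suc i < n → φ (A i) ≢ φ (A (suc i))
      walk-colours-differ W i+1<n =
        proper-adjacent-differ φ-proper (walk-turns W i+1<n) (Joins⇒Incʳ (walk-joins W (<⇒≤ i+1<n)))
          (Joins⇒Incˡ (walk-joins W i+1<n)) (proj₂ (oneOf-just (walk-colour W (<⇒≤ i+1<n))))

      ABPath⇒walk : ∀ {ψ α β v hs ws} (d : Edg) (dv : Vtx) → ABPath G r ψ α β v hs ws → Unique (v ∷ ws) →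
                    (∀ {j} → j < length hs → OneOf α β (φ (nth d hs j))) →
                    AlternatingWalk α β (nth dv (v ∷ ws)) (nth d hs) (length hs)
      ABPath⇒walk {v = v} {hs} {ws} d dv p distinct colour = record
        { walk-joins = ABPath-joins d dv p ; walk-colour = colour ; walk-turns = turns }
        where
        turns : ∀ {i} → suc i < length hs → nth d hs i ≢ nth d hs (suc i)
        turns {i} i+1<n same = <-irrefl i≡i+2 (m≤n⇒m≤1+n (n<1+n i))
          where
          back : Joins (nth d hs (suc i)) (nth dv (v ∷ ws) (suc i)) (nth dv (v ∷ ws) i)
          back = subst (λ g → Joins g _ _) same (Joins-sym (ABPath-joins d dv p (<⇒≤ i+1<n)))
          i≡i+2 : i ≡ suc (suc i)
          i≡i+2 = ABPath-vertex-injective dv p distinct (≤-trans (n≤1+n i) (<⇒≤ i+1<n)) i+1<n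
                    (Joins-functional back (ABPath-joins d dv p i+1<n))

      module _ {α β : Col} {a b : ℕ → Vtx} {A B : ℕ → Edg} {n δ : ℕ}
               (walkA : AlternatingWalk α β a A n) (walkB : AlternatingWalk α β b B (n + δ))
               (same-end : a n ≡ b (n + δ)) (end-α-free : Miss φ (a n) α) where

        private
          B-index : ∀ {i} → i < n → i + δ < n + δ
          B-index = +-monoˡ-< δ

        -- At the α-free end both walks arrive along β; further back, alternation forces equal colours.
        colours-agree : ∀ {i} → i < n → a (suc i) ≡ b (suc i + δ) → (suc i < n → A (suc i) ≡ B (suc i + δ)) →
                        φ (A i) ≡ φ (B (i + δ))
        colours-agree {i} i<n a≡b next with m≤n⇒m<n∨m≡n i<n
        ... | inj₂ i+1≡n =
          trans (α-free⇒β free (Joins⇒Incʳ (walk-joins walkA i<n)) (walk-colour walkA i<n))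
                (sym (α-free⇒β free B-arrives (walk-colour walkB (B-index i<n))))
          where
          free : Miss φ (a (suc i)) α
          free = subst (λ q → Miss φ (a q) α) (sym i+1≡n) end-α-free
          B-arrives : Inc (B (i + δ)) (a (suc i))
          B-arrives = subst (Inc _) (sym a≡b) (Joins⇒Incʳ (walk-joins walkB (B-index i<n)))
        ... | inj₁ i+1<n =
          oneOf-alternate (walk-colour walkA i<n) (walk-colour walkA i+1<n) (walk-colour walkB (B-index i<n))
            (walk-colours-differ walkA i+1<n)
            (λ eq → walk-colours-differ walkB (B-index i+1<n) (trans (sym eq) (cong φ (next i+1<n))))

        walks-agree-backwards : ∀ d {i} → i + d ≡ n → a i ≡ b (i + δ) × (i < n → A i ≡ B (i + δ))
        walks-agree-backwards zero {i} i+0≡n =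
          subst (λ q → a q ≡ b (q + δ)) (sym i≡n) same-end , λ i<n → ⊥-elim (<-irrefl i≡n i<n)
          where
          i≡n = trans (sym (+-identityʳ i)) i+0≡n
        walks-agree-backwards (suc d) {i} i+1+d≡n = a-agree , λ _ → A-agree
          where
          i<n : i < n
          i<n = subst (i <_) i+1+d≡n (m<m+n i (s≤s z≤n))
          next = walks-agree-backwards d (trans (sym (+-suc i d)) i+1+d≡n)
          B-joins : Joins (B (i + δ)) (b (i + δ)) (a (suc i))
          B-joins = subst (Joins _ _) (sym (proj₁ next)) (walk-joins walkB (B-index i<n))
          φA = proj₂ (oneOf-just (walk-colour walkA i<n))
          A-agree : A i ≡ B (i + δ)
          A-agree = proper-edge-unique φ-proper (Joins⇒Incʳ (walk-joins walkA i<n)) (Joins⇒Incʳ B-joins)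
                      φA (trans (sym (colours-agree i<n (proj₁ next) (proj₂ next))) φA)
          a-agree : a i ≡ b (i + δ)
          a-agree = Joins-functional (Joins-sym (walk-joins walkA i<n))
                      (subst (λ g → Joins g (a (suc i)) (b (i + δ))) (sym A-agree) (Joins-sym B-joins))

      walk-interior-not-β-free : ∀ {α β a A n i} → AlternatingWalk α β a A n → suc i < n → ¬ Miss φ (a (suc i)) β
      walk-interior-not-β-free W i+1<n β-free
        with oneOf-split (inj₂ refl) (walk-colour W (<⇒≤ i+1<n)) (walk-colour W i+1<n) (walk-colours-differ W i+1<n)
      ... | inj₁ β≡ = β-free _ (Joins⇒Incʳ (walk-joins W (<⇒≤ i+1<n))) (sym β≡)
      ... | inj₂ β≡ = β-free _ (Joins⇒Incˡ (walk-joins W i+1<n)) (sym β≡)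

      merge-into-longer : ∀ {α β a b A B n δ} → AlternatingWalk α β a A n → AlternatingWalk α β b B (n + δ) →
                          a n ≡ b (n + δ) → Miss φ (a n) α → Miss φ (a 0) β → a 0 ≢ b 0 → a 0 ≢ a n → ⊥
      merge-into-longer {n = zero} _ _ _ _ _ _ a₀≢aₙ = a₀≢aₙ refl
      merge-into-longer {n = suc n} {zero} walkA walkB same-end α-free _ a₀≢b₀ _ =
        a₀≢b₀ (proj₁ (walks-agree-backwards walkA walkB same-end α-free (suc n) refl))
      merge-into-longer {β = β} {n = suc n} {suc δ} walkA walkB same-end α-free a₀-β-free _ _ =
        walk-interior-not-β-free walkB (s≤s (m≤n+m (suc δ) n))
          (subst (λ v → Miss φ v β) (proj₁ (walks-agree-backwards walkA walkB same-end α-free (suc n) refl)) a₀-β-free)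

      alternating-walks-cannot-merge :
        ∀ {α β a b A B n m} → AlternatingWalk α β a A n → AlternatingWalk α β b B m → a n ≡ b m → Miss φ (a n) α →
        Miss φ (a 0) β → Miss φ (b 0) β → a 0 ≢ b 0 → a 0 ≢ a n → b 0 ≢ b m → ⊥
      alternating-walks-cannot-merge {α} {n = n} {m} walkA walkB same-end α-free a₀-β-free b₀-β-free a₀≢b₀ a₀≢aₙ b₀≢bₘ
        with ≤-total n m
      ... | inj₁ n≤m with m≤n⇒∃[o]m+o≡n n≤m
      ...   | _ , refl = merge-into-longer walkA walkB same-end α-free a₀-β-free a₀≢b₀ a₀≢aₙ
      alternating-walks-cannot-merge {α} walkA walkB same-end α-free a₀-β-free b₀-β-free a₀≢b₀ a₀≢aₙ b₀≢bₘ
        | inj₂ m≤n with m≤n⇒∃[o]m+o≡n m≤n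
      ...   | _ , refl = merge-into-longer walkB walkA (sym same-end) (subst (λ v → Miss φ v α) same-end α-free)
                           b₀-β-free (λ eq → a₀≢b₀ (sym eq)) b₀≢bₘ

      -- In case C the αβ-path from w (after shifting the fan) ends at x; the αβ-path from y
      -- cannot end there too, as w ≠ y both miss β while x misses α.
      caseC-end≢pivot : ∀ {e f x y w η α β P t P' t'} → Joins e x y →
        Miss φ x α → Miss φ y β → Miss φ w β → Miss φ y η → φ f ≡ just η →
        KempeChain G r (Shift φ (e ∷ f ∷ [])) α β f x w P t → t ≡ x → KempeChain G r φ α β e x y P' t' → t' ≢ x
      caseC-end≢pivot {e} {f} {x} {y} {w} e-xy x-α y-β w-β y-η φf≡η
        record { hs = hsA ; ws = wsA ; ends-h = f-xw ; path = pathA ; distinct = distinctA ; vEnd = vEndA } t≡x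
        record { hs = hs ; ws = ws ; path = path ; distinct = distinct ; vEnd = vEnd } t'≡x =
        alternating-walks-cannot-merge walkA walkB (trans endA (sym endB)) (subst (λ v → Miss φ v _) (sym endA) x-α)
          w-β y-β w≢y (λ w≡ → Joins⇒≢ f-xw (sym (trans w≡ endA))) (λ y≡ → Joins⇒≢ e-xy (sym (trans y≡ endB)))
        where
        walkA = ABPath⇒walk f w pathA distinctA λ j< →
                  let αβ = ABPath-colour f pathA j< in subst (OneOf _ _) (fan-shift-keeps-αβ _ f-xw x-α w-β αβ) αβ
        walkB = ABPath⇒walk e y path distinct (ABPath-colour e path)
        endA : nth w (w ∷ wsA) (length hsA) ≡ x
        endA = trans (sym (ABPath-end w pathA)) (trans (sym vEndA) t≡x)
        endB : nth y (y ∷ ws) (length hs) ≡ x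
        endB = trans (sym (ABPath-end y path)) (trans (sym vEnd) t'≡x)
        w≢y : w ≢ y
        w≢y w≡y = y-η f (subst (Inc f) w≡y (Joins⇒Incʳ f-xw)) φf≡η

      fan₃-missing : ∀ {f x y z w α β} → Joins f x z → Joins f x w →
                     IsMin G r (CommonMissing G r φ y z) β → IsMin G r (Miss φ x) α →
                     Miss φ x α × Miss φ y β × Miss φ w β
      fan₃-missing f-xz f-xw ((y-β , z-β) , _) (x-α , _) =
        x-α , y-β , subst (λ v → Miss φ v _) (Joins-functional f-xz f-xw) z-β

      shannonChain⇒layout : ∀ {e x F P α β t} → ShannonChain G r φ e x F P α β t → Layout φ (_+C_ G F P) F t α β
      shannonChain⇒layout (caseA _ e-xy (fan1 _) _ e-xt)                 = caseA₁-layout e-xy e-xt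
      shannonChain⇒layout (caseA _ e-xy (fan2 _ _ f-xz _ _) _ f-xt)       = caseA₂-layout e-xy f-xz f-xt
      shannonChain⇒layout (caseA _ e-xy (fan3 _ _ f-xz _ _ _ _) _ f-xt)   = caseA₂-layout e-xy f-xz f-xt
      shannonChain⇒layout (caseB _ _ (fan1 ((x-β , _) , _)) x-β̸ _ _ _)       = ⊥-elim (x-β̸ x-β)
      shannonChain⇒layout (caseB _ _ (fan2 _ _ _ _ ((x-β , _) , _)) x-β̸ _ _ _) = ⊥-elim (x-β̸ x-β)
      shannonChain⇒layout (caseB _ e-xy (fan3 _ _ f-xz _ _ β-min α-min) _ f-xw K t≢x)
        with fan₃-missing f-xz f-xw β-min α-min
      ... | x-α , y-β , w-β = caseB-layout e-xy x-α y-β w-β K t≢x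
      shannonChain⇒layout (caseC _ _ (fan1 ((x-β , _) , _)) x-β̸ _ _ _ _)       = ⊥-elim (x-β̸ x-β)
      shannonChain⇒layout (caseC _ _ (fan2 _ _ _ _ ((x-β , _) , _)) x-β̸ _ _ _ _) = ⊥-elim (x-β̸ x-β)
      shannonChain⇒layout (caseC _ e-xy (fan3 _ (y-η , _) f-xz φf≡η _ β-min α-min) _ f-xw K t≡x K')
        with fan₃-missing f-xz f-xw β-min α-min
      ... | x-α , y-β , w-β = caseC-layout x-α y-β K' (caseC-end≢pivot e-xy x-α y-β w-β y-η φf≡η K t≡x K')

lemma3p2 : (G : Multigraph) (Δ : ℕ) → 2 ≤ Δ → MaxDegree G Δ →
    (φ : Coloring G ((3 * Δ) / 2)) → Proper G ((3 * Δ) / 2) φ →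
    (e₁ : Edge G) (x₁ : Vertex G) (F₁ P₁ : List⁺ (Edge G))
    (α₁ β₁ : Color G ((3 * Δ) / 2)) (t₁ : Vertex G) →
    ShannonChain G ((3 * Δ) / 2) φ e₁ x₁ F₁ P₁ α₁ β₁ t₁ →
    (e₂ : Edge G) (x₂ : Vertex G) (F₂ P₂ : List⁺ (Edge G))
    (α₂ β₂ : Color G ((3 * Δ) / 2)) (t₂ : Vertex G) →
    ShannonChain G ((3 * Δ) / 2) φ e₂ x₂ F₂ P₂ α₂ β₂ t₂ →
    IsChain G (_+C_ G F₁ P₁) → IsChain G (_+C_ G F₂ P₂) →
    HappyChain G ((3 * Δ) / 2) φ (_+C_ G F₁ P₁) →
    HappyChain G ((3 * Δ) / 2) φ (_+C_ G F₂ P₂) →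
    Disjoint G ((3 * Δ) / 2) F₁ P₁ t₁ F₂ P₂ t₂ →
    ((γ : Color G ((3 * Δ) / 2)) →
       AugColor G ((3 * Δ) / 2) φ (_+C_ G F₂ P₂) α₂ β₂ γ →
       HappyChain G ((3 * Δ) / 2) (aug G ((3 * Δ) / 2) φ (_+C_ G F₂ P₂) γ) (_+C_ G F₁ P₁))
    × ((γ : Color G ((3 * Δ) / 2)) →
       AugColor G ((3 * Δ) / 2) φ (_+C_ G F₁ P₁) α₁ β₁ γ →
       HappyChain G ((3 * Δ) / 2) (aug G ((3 * Δ) / 2) φ (_+C_ G F₁ P₁) γ) (_+C_ G F₂ P₂))
lemma3p2 G Δ _ _ φ φ-proper _ _ _ _ _ _ _ chain₁ _ _ _ _ _ _ _ chain₂ (unique₁ , _) (unique₂ , _)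
         happy₁ happy₂ (edges-disjoint , anchors-disjoint) =
  (λ _ γ-aug → Interaction.stays-happy G r φ-proper anchored₁ anchored₂ happy₁ happy₂
                 edges-disjoint anchors-disjoint γ-aug) ,
  (λ _ γ-aug → Interaction.stays-happy G r φ-proper anchored₂ anchored₁ happy₂ happy₁
                 (λ g g∈₂ g∈₁ → edges-disjoint g g∈₁ g∈₂) (λ v A₂ A₁ → anchors-disjoint v A₁ A₂) γ-aug)
  where
  r = (3 * Δ) / 2
  anchored₁ = LayoutProperties.anchored G r φ-proper unique₁ (ShannonLayouts.shannonChain⇒layout G r φ-proper chain₁)
  anchored₂ = LayoutProperties.anchored G r φ-proper unique₂ (ShannonLayouts.shannonChain⇒layout G r φ-proper chain₂)
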